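{- Let $G=(V,E)$ be a graph, $q\ge 2$, $0<\gamma<1$, and let $X,Y\in[q]^V$ be two colorings differing at exactly one node $v_0$, with $X_{v_0}=r$, $Y_{v_0}=b$, $r\neq b$. Let $(X',Y')$ be obtained from $(X,Y)$ by one step of the coupling of the local Glauber dynamics described in the context. If $X'_v\neq Y'_v$ for some node $v\neq v_0$ with $v\in S$, then there exist $\ell\ge 1$ and a path $(v_0,v_1,\dots,v_\ell=v)$ in $G$ (consecutive nodes adjacent) with $v_i\in F^i$ for all $0\le i\le \ell$, such that $c_v^X=c_Y\neq c_X=c_v^Y$, where $c_X=c^X_{v_{\ell-1}}$, $c_Y=c^Y_{v_{\ell-1}}$ if $\ell>1$, and $c_X=X_{v_0}$, $c_Y=Y_{v_0}$ if $\ell=1$.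
   Context: Local Glauber dynamics step (from $X$ to $X'$): every node $v$ independently marks itself with probability $\gamma$; a marked node proposes a color $c_v\in[q]$, an unmarked node has $c_v:=X_v$. A marked node $v$ sets $X'_v=c_v$ if $c_v\notin\bigcup_{u\in N(v)}\{X_u,c_u\}$ and $c_u\notin\{X_v,c_v\}$ for every $u\in N(v)$; otherwise (and if unmarked) $X'_v=X_v$. Here $N(v)$ is the set of neighbors of $v$, $N^+(v)=N(v)\cup\{v\}$. Coupling of one step for $X,Y$ as in the claim: both chains use the same marks. Each node $v$ gets a pair of proposals $(c_v^X,c_v^Y)$ used in the respective chain (unmarked nodes: $c_v^X=X_v$, $c_v^Y=Y_v$). For a marked node, proposals are sampled either consistently: $c_v^X=c_v^Y=c$ for $c$ uniform in $[q]$; or mirroredly: $c$ uniform in $[q]$, and $c_v^X=c_v^Y=c$ if $c\notin\{r,b\}$, while if $c\in\{r,b\}$ then $c_v^X=c$ and $c_v^Y$ is the other element of $\{r,b\}$. A node has flipped proposals if $c_v^X\neq c_v^Y$. Let $B=\{v\in V\setminus\{v_0\}: X_v\in\{r,b\}\}$, $K=\left(\bigcup_{v\in B}N^+(v)\right)\setminus\{v_0\}$, and $S$ the set of marked nodes not in $K$. Set $M^0=F^0=\{v_0\}$; $v_0$ (if marked) samples consistently. For $d\ge0$, let $M^{d+1}=(N(F^d)\cap S)\setminus\bigcup_{i=0}^{d}M^i$, nodes in $M^{d+1}$ sample mirroredly, and $F^{d+1}=\{v\in M^{d+1}: c_v^X\neq c_v^Y\}$. All remaining marked nodes (those in $S\setminus\bigcup_d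 M^d$ and those in $K$) sample consistently, and all samples are independent. Then $X'$ and $Y'$ are obtained by applying the acceptance rule above to $(X,(c^X_v)_v)$ and $(Y,(c^Y_v)_v)$ respectively. -}

module Defs where

open import Data.Nat using (ℕ; zero; suc)
open import Data.Fin using (Fin; _≟_)
open import Data.Bool using (Bool; true; false; not; _∧_; _∨_; if_then_else_)
open import Data.List using (map; allFin)
open import Data.Bool.ListAction using (and)
open import Data.Product using (Σ; ∃; _×_)
open import Data.Sum using (_⊎_)
open import Relation.Nullary using (¬_)
open import Relation.Nullary.Decidable using (⌊_⌋)
open import Relation.Binary.PropositionalEquality using (_≡_; _≢_)

record Graph : Set where
  field
    n      : ℕ
    adj    : Fin n → Fin n → Bool
    sym    : ∀ u v → adj u v ≡ adj v u
    irrefl : ∀ v → adj v v ≡ false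

open Graph public

Adj : (G : Graph) → Fin (n G) → Fin (n G) → Set
Adj G u v = adj G u v ≡ true

_==_ : ∀ {q} → Fin q → Fin q → Bool
a == b = ⌊ a ≟ b ⌋

swap : ∀ {q} → Fin q → Fin q → Fin q → Fin q
swap r b c = if c == r then b else (if c == b then r else c)

-- Acceptance rule of the local Glauber dynamics for node v, given the current
-- colouring X and proposals c (c u = X u for unmarked u):
-- for every neighbour u: c v ∉ {X u, c u} and c u ∉ {X v, c v}.
accept : (G : Graph) {q : ℕ} → (X c : Fin (n G) → Fin q) → Fin (n G) → Bool
accept G X c v = and (map ok (allFin (n G)))
  where
  ok : Fin (n G) → Bool
  ok u = not (adj G v u) ∨
         (not (c v == X u) ∧ not (c v == c u) ∧ not (c u == X v))

step : (G : Graph) {q : ℕ} → (X c : Fin (n G) → Fin q) → (mark : Fin (n G) → Bool)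
     → Fin (n G) → Fin q
step G X c mark v = if mark v ∧ accept G X c v then c v else X v

pick : {A : Set} → ℕ → A → A → A
pick zero    a _ = a
pick (suc _) _ b = b

module Coupling (G : Graph) {q : ℕ} (X : Fin (n G) → Fin q) (v0 : Fin (n G))
                (r b : Fin q) (mark : Fin (n G) → Bool)
                (cX cY : Fin (n G) → Fin q) where

  V : Set
  V = Fin (n G)

  B : V → Set
  B v = v ≢ v0 × (X v ≡ r ⊎ X v ≡ b)

  K : V → Set
  K v = v ≢ v0 × ∃ λ u → B u × (u ≡ v ⊎ Adj G u v)

  S : V → Set
  S v = mark v ≡ true × ¬ K v

  mutual
    M : ℕ → V → Set
    M zero    v = v ≡ v0
    M (suc d) v = (∃ λ u → Adj G u v × F d u) × S v × ¬ U d v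

    U : ℕ → V → Set
    U zero    v = M zero v
    U (suc d) v = U d v ⊎ M (suc d) v

    F : ℕ → V → Set
    F zero    v = v ≡ v0
    F (suc d) v = M (suc d) v × cX v ≢ cY v

  Mirrored : V → Set
  Mirrored v = ∃ λ d → M (suc d) v

  -- (mark, cX, cY) lies in the support of the coupled proposal sampling.
  record Support (Y : V → Fin q) : Set where
    field
      unmarked  : ∀ v → mark v ≡ false → cX v ≡ X v × cY v ≡ Y v
      mirrored  : ∀ v → mark v ≡ true → Mirrored v → cY v ≡ swap r b (cX v)
      consistent : ∀ v → mark v ≡ true → ¬ Mirrored v → cX v ≡ cY v

-- A disagreement at v ≠ v0 needs the proposals of v to differ, which only a
-- mirrored node can achieve; so v ∈ M^{d+1} has a neighbour w ∈ F^d, and the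
-- levels F^0, …, F^d yield the path.  Since v ∉ K, its colour avoids {r, b};
-- if its two proposals agreed they would also avoid {r, b}, and such a node
-- cannot tell the two chains apart, as every node's colours and proposals
-- agree in both chains up to exchanging r and b.  Hence the proposals of v are
-- r and b in some order.  The pair (a, a') that w offers (its colours if
-- w = v0, its proposals otherwise) is also r, b in some order; cX v = a would
-- make both chains reject at v, so cX v = a' and cY v = a.
module Submission where

open import Defs hiding (sym)
open import Data.Nat using (ℕ; zero; suc; _≤_; _<_; z≤n; s≤s; s≤s⁻¹; _≤?_; _<?_)
open import Data.Nat.Properties using (≤-refl; <-irrefl; <⇒≤; <-≤-trans; ≮⇒≥; m≤n⇒m<n∨m≡n; m<1+n⇒m<n∨m≡n; anyUpTo?)
open import Data.Fin using (Fin; toℕ; _≟_)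
open import Data.Fin.Properties using (any?; pigeonhole; toℕ<n)
open import Data.Bool using (Bool; true; false; not; _∧_; _∨_; if_then_else_; T)
open import Data.Bool.Properties using (∧-zeroʳ) renaming (_≟_ to _≟ᵇ_)
open import Data.Bool.ListAction using (and)
open import Data.List using (map; allFin)
open import Data.List.Properties using (map-cong)
open import Data.List.Relation.Unary.All using (lookup)
open import Data.List.Relation.Unary.All.Properties using (all⁺)
open import Data.List.Membership.Propositional.Properties using (∈-allFin)
open import Data.Product using (∃; _×_; _,_; proj₁; proj₂)
open import Data.Sum using (_⊎_; inj₁; inj₂)
open import Data.Empty using (⊥-elim)
open import Relation.Nullary using (¬_; Dec; yes; no; contradiction)
open import Relation.Nullary.Decidable using (isYes≗does; dec-true; dec-false; map′; _×-dec_; _⊎-dec_; ¬?)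
open import Relation.Binary.PropositionalEquality using (_≡_; _≢_; refl; sym; trans; cong; cong₂; subst; subst₂)

==-refl : ∀ {q} (a : Fin q) → (a == a) ≡ true
==-refl a = trans (isYes≗does (a ≟ a)) (dec-true (a ≟ a) refl)

==-≢ : ∀ {q} {a c : Fin q} → a ≢ c → (a == c) ≡ false
==-≢ {a = a} {c} a≢c = trans (isYes≗does (a ≟ c)) (dec-false (a ≟ c) a≢c)

conflictFree : ∀ {q} (cv xu cu xv : Fin q) → Bool
conflictFree cv xu cu xv = not (cv == xu) ∧ not (cv == cu) ∧ not (cu == xv)

conflictFree-pick : ∀ {q} k (xu cu xv : Fin q) → conflictFree (pick k xu cu) xu cu xv ≡ false
conflictFree-pick zero    xu cu xv rewrite ==-refl xu = refl
conflictFree-pick (suc k) xu cu xv rewrite ==-refl cu = ∧-zeroʳ (not (cu == xu))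

module _ (G : Graph) {q : ℕ} (mark : Fin (n G) → Bool) where

  step-rejected : ∀ (X c : Fin (n G) → Fin q) {v u} → Adj G v u
                → conflictFree (c v) (X u) (c u) (X v) ≡ false → step G X c mark v ≡ X v
  step-rejected X c {v} {u} v~u conflict with accept G X c v in accepted
  ... | false = cong (if_then c v else X v) (∧-zeroʳ (mark v))
  ... | true  = ⊥-elim (subst T ok-u≡false (lookup allOk (∈-allFin u)))
    where
    ok : Fin (n G) → Bool
    ok u = not (adj G v u) ∨ conflictFree (c v) (X u) (c u) (X v)
    allOk = all⁺ ok (allFin (n G)) (subst T (sym accepted) _)
    ok-u≡false : ok u ≡ false
    ok-u≡false rewrite v~u = conflict

  step-cong : ∀ (X Y cX cY : Fin (n G) → Fin q) {v} → X v ≡ Y v → cX v ≡ cY v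
            → (∀ u → Adj G v u → conflictFree (cX v) (X u) (cX u) (X v)
                                  ≡ conflictFree (cX v) (Y u) (cY u) (X v))
            → step G X cX mark v ≡ step G Y cY mark v
  step-cong X Y cX cY {v} Xv≡Yv cXv≡cYv same =
    trans (cong (λ a → if mark v ∧ a then cX v else X v) accept-≡)
          (cong₂ (λ c x → if mark v ∧ accept G Y cY v then c else x) cXv≡cYv Xv≡Yv)
    where
    ok-≡ : ∀ u → not (adj G v u) ∨ conflictFree (cX v) (X u) (cX u) (X v)
                ≡ not (adj G v u) ∨ conflictFree (cY v) (Y u) (cY u) (Y v)
    ok-≡ u with adj G v u in v~u
    ... | false = refl
    ... | true rewrite sym cXv≡cYv | sym Xv≡Yv = same u v~u
    accept-≡ : accept G X cX v ≡ accept G Y cY v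
    accept-≡ = cong and (map-cong ok-≡ (allFin (n G)))

module Swap {q : ℕ} (r b : Fin q) where

  RB : Fin q → Set
  RB c = c ≡ r ⊎ c ≡ b

  -- Indistinguishable for a node whose colour and proposal avoid r and b.
  _∼_ : Fin q → Fin q → Set
  a ∼ a′ = a ≡ a′ ⊎ (RB a × RB a′)

  ∼-swap : ∀ c → c ∼ swap r b c
  ∼-swap c with c ≟ r | c ≟ b
  ... | yes c≡r | _       = inj₂ (inj₁ c≡r , inj₂ refl)
  ... | no _    | yes c≡b = inj₂ (inj₂ c≡b , inj₁ refl)
  ... | no _    | no _    = inj₁ refl

  ¬RB⇒≢ : ∀ {c a} → ¬ RB c → RB a → c ≢ a
  ¬RB⇒≢ ¬RBc RBa refl = ¬RBc RBa

  conflictFree-∼ : ∀ {c x xu xu′ cu cu′} → ¬ RB c → ¬ RB x → xu ∼ xu′ → cu ∼ cu′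
                 → conflictFree c xu cu x ≡ conflictFree c xu′ cu′ x
  conflictFree-∼ {c} {x} {xu} {xu′} {cu} {cu′} ¬RBc ¬RBx xu∼xu′ cu∼cu′ =
    trans (cong₂ (λ s t → not s ∧ not (c == cu) ∧ not t) (==ʳ xu∼xu′) (==ˡ cu∼cu′))
          (cong (λ s → not (c == xu′) ∧ not s ∧ not (cu′ == x)) (==ʳ cu∼cu′))
    where
    ==ʳ : ∀ {a a′} → a ∼ a′ → (c == a) ≡ (c == a′)
    ==ʳ (inj₁ refl)         = refl
    ==ʳ (inj₂ (RBa , RBa′)) = trans (==-≢ (¬RB⇒≢ ¬RBc RBa)) (sym (==-≢ (¬RB⇒≢ ¬RBc RBa′)))
    ==ˡ : ∀ {a a′} → a ∼ a′ → (a == x) ≡ (a′ == x)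
    ==ˡ (inj₁ refl)         = refl
    ==ˡ (inj₂ (RBa , RBa′)) = trans (==-≢ (λ a≡x → ¬RB⇒≢ ¬RBx RBa (sym a≡x)))
                                    (sym (==-≢ (λ a′≡x → ¬RB⇒≢ ¬RBx RBa′ (sym a′≡x))))

  swap-r : swap r b r ≡ b
  swap-r rewrite ==-refl r = refl

  module _ (r≢b : r ≢ b) where

    swap-b : swap r b b ≡ r
    swap-b rewrite ==-≢ (λ b≡r → r≢b (sym b≡r)) | ==-refl b = refl

    swap-involutive : ∀ {c} → RB c → swap r b (swap r b c) ≡ c
    swap-involutive (inj₁ refl) = trans (cong (swap r b) swap-r) swap-b
    swap-involutive (inj₂ refl) = trans (cong (swap r b) swap-b) swap-r

    swap-moves : ∀ {c} → RB c → swap r b c ≢ c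
    swap-moves (inj₁ refl) b≡r = r≢b (sym (trans (sym swap-r) b≡r))
    swap-moves (inj₂ refl) r≡b = r≢b (trans (sym swap-b) r≡b)

    moved⇒RB : ∀ {c} → swap r b c ≢ c → RB c
    moved⇒RB {c} moved with ∼-swap c
    ... | inj₁ c≡swap-c  = contradiction (sym c≡swap-c) moved
    ... | inj₂ (RBc , _) = RBc

    RB-≢⇒swap : ∀ {a c} → RB a → RB c → a ≢ c → a ≡ swap r b c
    RB-≢⇒swap (inj₁ refl) (inj₁ refl) a≢c = contradiction refl a≢c
    RB-≢⇒swap (inj₁ refl) (inj₂ refl) _   = sym swap-b
    RB-≢⇒swap (inj₂ refl) (inj₁ refl) _   = sym swap-r
    RB-≢⇒swap (inj₂ refl) (inj₂ refl) a≢c = contradiction refl a≢c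

extend : ∀ {A : Set} → (ℕ → A) → ℕ → A → ℕ → A
extend p d w i with i ≤? d
... | yes _ = p i
... | no _  = w

extend-≤ : ∀ {A : Set} (p : ℕ → A) {d} w {i} → i ≤ d → extend p d w i ≡ p i
extend-≤ p {d} w {i} i≤d with i ≤? d
... | yes _  = refl
... | no i≰d = contradiction i≤d i≰d

extend-suc : ∀ {A : Set} (p : ℕ → A) d w → extend p d w (suc d) ≡ w
extend-suc p d w with suc d ≤? d
... | yes d<d = contradiction d<d (<-irrefl refl)
... | no _    = refl

module CouplingFacts (G : Graph) {q : ℕ} (X : Fin (n G) → Fin q) (v0 : Fin (n G))
                     (r b : Fin q) (mark : Fin (n G) → Bool) (cX cY : Fin (n G) → Fin q) where

  open Coupling G X v0 r b mark cX cY

  Adj? : ∀ u w → Dec (Adj G u w)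
  Adj? u w = adj G u w ≟ᵇ true

  Adj-sym : ∀ {u w} → Adj G u w → Adj G w u
  Adj-sym {u} {w} u~w = trans (Graph.sym G w u) u~w

  B? : ∀ u → Dec (B u)
  B? u = ¬? (u ≟ v0) ×-dec (X u ≟ r ⊎-dec X u ≟ b)

  K? : ∀ w → Dec (K w)
  K? w = ¬? (w ≟ v0) ×-dec any? (λ u → B? u ×-dec (u ≟ w ⊎-dec Adj? u w))

  S? : ∀ w → Dec (S w)
  S? w = (mark w ≟ᵇ true) ×-dec ¬? (K? w)

  mutual
    M? : ∀ d w → Dec (M d w)
    M? zero    w = w ≟ v0
    M? (suc d) w = any? (λ u → Adj? u w ×-dec F? d u) ×-dec S? w ×-dec ¬? (U? d w)

    U? : ∀ d w → Dec (U d w)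
    U? zero    w = M? zero w
    U? (suc d) w = U? d w ⊎-dec M? (suc d) w

    F? : ∀ d w → Dec (F d w)
    F? zero    w = w ≟ v0
    F? (suc d) w = M? (suc d) w ×-dec ¬? (cX w ≟ cY w)

  F⊆M : ∀ {d w} → F d w → M d w
  F⊆M {zero}  f       = f
  F⊆M {suc d} (m , _) = m

  M⊆U : ∀ {i k w} → i ≤ k → M i w → U k w
  M⊆U {k = zero}  z≤n m = m
  M⊆U {k = suc k} i≤k m with m≤n⇒m<n∨m≡n i≤k
  ... | inj₁ i<k  = inj₁ (M⊆U (s≤s⁻¹ i<k) m)
  ... | inj₂ refl = inj₂ m

  U⇒M : ∀ {d w} → U d w → ∃ λ i → M i w
  U⇒M {zero}  u        = zero , u
  U⇒M {suc d} (inj₁ u) = U⇒M {d} u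
  U⇒M {suc d} (inj₂ m) = suc d , m

  M-disjoint : ∀ {i j w} → i < j → M i w → ¬ M j w
  M-disjoint {j = suc j} (s≤s i≤j) mᵢ (_ , _ , ¬U) = ¬U (M⊆U i≤j mᵢ)

  S-neighbour-mirrored : ∀ {d u v} → S v → v ≢ v0 → Adj G u v → F d u → Mirrored v
  S-neighbour-mirrored {d} {u} {v} Sv v≢v0 u~v f with U? d v
  ... | no ¬U = d , (u , u~v , f) , Sv , ¬U
  ... | yes Uv with U⇒M {d} Uv
  ...   | zero  , v≡v0 = contradiction v≡v0 v≢v0
  ...   | suc i , m    = i , m

  record Walk (d : ℕ) (u : V) : Set where
    field
      path   : ℕ → V
      start  : path 0 ≡ v0
      end    : path d ≡ u
      steps  : ∀ i → i < d → Adj G (path i) (path (suc i))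
      levels : ∀ i → i < d → F i (path i)

  open Walk

  walk-snoc : ∀ {d w u} → Walk d w → F d w → Adj G w u → Walk (suc d) u
  walk-snoc {d} {w} {u} wk Fw w~u = record
    { path   = extend (path wk) d u
    ; start  = trans (extend-≤ (path wk) {d} u z≤n) (start wk)
    ; end    = extend-suc (path wk) d u
    ; steps  = steps′
    ; levels = levels′
    }
    where
    steps′ : ∀ i → i < suc d → Adj G (extend (path wk) d u i) (extend (path wk) d u (suc i))
    steps′ i i<1+d with m<1+n⇒m<n∨m≡n i<1+d
    ... | inj₁ i<d rewrite extend-≤ (path wk) u (<⇒≤ i<d) | extend-≤ (path wk) u i<d = steps wk i i<d
    ... | inj₂ refl rewrite extend-≤ (path wk) u (≤-refl {d}) | extend-suc (path wk) d u | end wk = w~u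
    levels′ : ∀ i → i < suc d → F i (extend (path wk) d u i)
    levels′ i i<1+d rewrite extend-≤ (path wk) u (s≤s⁻¹ i<1+d) with m<1+n⇒m<n∨m≡n i<1+d
    ... | inj₁ i<d  = levels wk i i<d
    ... | inj₂ refl = subst (F d) (sym (end wk)) Fw

  walk-snoc-penultimate : ∀ {d w u} (wk : Walk d w) (Fw : F d w) (w~u : Adj G w u)
                        → path (walk-snoc wk Fw w~u) d ≡ w
  walk-snoc-penultimate wk _ _ = trans (extend-≤ (path wk) _ ≤-refl) (end wk)

  walk : ∀ {d u} → F d u → Walk d u
  walk {zero}  {u} u≡v0 = record
    { path = λ _ → u ; start = u≡v0 ; end = refl ; steps = λ _ () ; levels = λ _ () }
  walk {suc d} (((w , w~u , Fw) , _) , _) = walk-snoc (walk Fw) Fw w~u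

  levels-≤ : ∀ {P : ℕ → V → Set} {d u} (wk : Walk d u) → (∀ {i x} → F i x → P i x) → P d u
           → ∀ i → i ≤ d → P i (path wk i)
  levels-≤ {P} wk F⇒P Pdu i i≤d with m≤n⇒m<n∨m≡n i≤d
  ... | inj₁ i<d  = F⇒P (levels wk i i<d)
  ... | inj₂ refl = subst (P i) (sym (end wk)) Pdu

  -- The levels along a walk are pairwise disjoint, so a walk has at most n G nodes.
  mirrored-level-bound : ∀ {d x} → M (suc d) x → suc d < n G
  mirrored-level-bound {d} {x} m@((w , w~x , Fw) , _) = bound (walk-snoc (walk Fw) Fw w~x)
    where
    bound : Walk (suc d) x → suc d < n G
    bound wk with n G <? suc (suc d)
    ... | no  n≮2+d = ≮⇒≥ n≮2+d
    ... | yes n<2+d with pigeonhole n<2+d (λ i → path wk (toℕ i))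
    ...   | i , j , i<j , same =
      ⊥-elim (M-disjoint i<j (level (toℕ i) (<⇒≤ (<-≤-trans i<j j≤1+d)))
                     (subst (M (toℕ j)) (sym same) (level (toℕ j) j≤1+d)))
      where
      j≤1+d = s≤s⁻¹ (toℕ<n j)
      level : ∀ i → i ≤ suc d → M i (path wk i)
      level = levels-≤ {P = M} wk F⊆M m

  Mirrored? : ∀ x → Dec (Mirrored x)
  Mirrored? x = map′ (λ (d , _ , m) → d , m) (λ (d , m) → d , <⇒≤ (mirrored-level-bound m) , m)
                     (anyUpTo? (λ d → M? (suc d) x) (n G))

module CoupledStep (G : Graph) {q : ℕ} (X Y : Fin (n G) → Fin q) (v0 : Fin (n G)) (r b : Fin q)
                   (r≢b : r ≢ b) (Xv0≡r : X v0 ≡ r) (Yv0≡b : Y v0 ≡ b) (agree : ∀ u → u ≢ v0 → X u ≡ Y u)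
                   (mark : Fin (n G) → Bool) (cX cY : Fin (n G) → Fin q)
                   (supp : Coupling.Support G X v0 r b mark cX cY Y) where

  open Coupling G X v0 r b mark cX cY
  open CouplingFacts G X v0 r b mark cX cY
  open Swap r b
  open Support supp renaming (mirrored to swapped-if-mirrored)

  proposal-mirrored : ∀ {d u} → M (suc d) u → cY u ≡ swap r b (cX u)
  proposal-mirrored {d} m@(_ , (marked , _) , _) = swapped-if-mirrored _ marked (d , m)

  colours-∼ : ∀ u → X u ∼ Y u
  colours-∼ u with u ≟ v0
  ... | yes refl = inj₂ (inj₁ Xv0≡r , inj₂ Yv0≡b)
  ... | no u≢v0  = inj₁ (agree u u≢v0)

  proposals-∼ : ∀ u → cX u ∼ cY u
  proposals-∼ u with Mirrored? u | mark u in marked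
  ... | _ | false = subst₂ _∼_ (sym (proj₁ (unmarked u marked))) (sym (proj₂ (unmarked u marked)))
                           (colours-∼ u)
  ... | yes mir | true = subst (cX u ∼_) (sym (swapped-if-mirrored u marked mir)) (∼-swap (cX u))
  ... | no ¬mir | true = inj₁ (consistent u marked ¬mir)

  flipped-proposals : ∀ {d u} → F (suc d) u → RB (cX u) × cY u ≡ swap r b (cX u)
  flipped-proposals (m , cX≢cY) =
    moved⇒RB r≢b (λ swapped → cX≢cY (sym (trans (proposal-mirrored m) swapped))) , proposal-mirrored m

  -- What a node w ∈ F^d offers to its neighbours: its colours if d = 0 (w = v0), else its proposals.
  offered-swapped : ∀ {d w} → F d w
                  → RB (pick d (X v0) (cX w)) × pick d (Y v0) (cY w) ≡ swap r b (pick d (X v0) (cX w))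
  offered-swapped {zero}  _  = inj₁ Xv0≡r , trans Yv0≡b (sym (trans (cong (swap r b) Xv0≡r) swap-r))
  offered-swapped {suc d} Fw = flipped-proposals Fw

  offered-blocks : ∀ (Z c : V → Fin q) {d w} → F d w
                 → ∀ x → conflictFree (pick d (Z v0) (c w)) (Z w) (c w) x ≡ false
  offered-blocks Z c {zero}  refl = conflictFree-pick zero (Z v0) (c v0)
  offered-blocks Z c {suc d} {w} _ = conflictFree-pick (suc d) (Z w) (c w)

  CrossedProposals : ℕ → V → V → Set
  CrossedProposals d w v = cX v ≡ pick d (Y v0) (cY w) × pick d (Y v0) (cY w) ≢ pick d (X v0) (cX w)
                         × pick d (X v0) (cX w) ≡ cY v

  module Disagreement {v} (v≢v0 : v ≢ v0) (Sv : S v) (differs : step G X cX mark v ≢ step G Y cY mark v) where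

    colour-avoids-rb : ¬ RB (X v)
    colour-avoids-rb rb = proj₂ Sv (v≢v0 , v , (v≢v0 , rb) , inj₁ refl)

    neighbour-agrees : ¬ Mirrored v → ∀ {u} → Adj G v u → X u ≡ Y u × cX u ≡ cY u
    neighbour-agrees ¬mir {u} v~u = agree u u≢v0 , proposals-agree
      where
      u≢v0 : u ≢ v0
      u≢v0 refl = ¬mir (S-neighbour-mirrored Sv v≢v0 (Adj-sym v~u) refl)
      proposals-agree : cX u ≡ cY u
      proposals-agree with cX u ≟ cY u | mark u in marked
      ... | yes same | _     = same
      ... | no  _    | false = let cX≡X , cY≡Y = unmarked u marked
                               in trans cX≡X (trans (agree u u≢v0) (sym cY≡Y))
      ... | no  cX≢cY | true = consistent u marked λ (d , m) →
                                 ¬mir (S-neighbour-mirrored Sv v≢v0 (Adj-sym v~u) (m , cX≢cY))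

    mirrored : Mirrored v
    mirrored with Mirrored? v
    ... | yes mir = mir
    ... | no ¬mir = contradiction
        (step-cong G mark X Y cX cY (agree v v≢v0) (consistent v (proj₁ Sv) ¬mir)
                   λ u v~u → cong₂ (λ xu cu → conflictFree (cX v) xu cu (X v))
                                   (proj₁ (neighbour-agrees ¬mir v~u)) (proj₂ (neighbour-agrees ¬mir v~u)))
        differs

    proposals-flipped : ∀ {d} → M (suc d) v → cX v ≢ cY v
    proposals-flipped m cX≡cY = differs
      (step-cong G mark X Y cX cY (agree v v≢v0) cX≡cY
                 λ u _ → conflictFree-∼ proposal-avoids-rb colour-avoids-rb (colours-∼ u) (proposals-∼ u))
      where
      proposal-avoids-rb : ¬ RB (cX v)
      proposal-avoids-rb rb = swap-moves r≢b rb (trans (sym (proposal-mirrored m)) (sym cX≡cY))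

    crossed : ∀ {d w} → F d w → Adj G w v → M (suc d) v → CrossedProposals d w v
    crossed {d} {w} Fw w~v m = trans cX≡swap-a (sym a′≡swap-a) , a′≢a , sym cY≡a
      where
      a  = pick d (X v0) (cX w)
      a′ = pick d (Y v0) (cY w)
      RBa = proj₁ (offered-swapped Fw)
      a′≡swap-a = proj₂ (offered-swapped Fw)
      cY≡swap-cX = proposal-mirrored m
      RBcX : RB (cX v)
      RBcX = moved⇒RB r≢b λ swapped → proposals-flipped m (sym (trans cY≡swap-cX swapped))
      cX≢a : cX v ≢ a
      cX≢a cX≡a = differs (trans rejectedX (trans (agree v v≢v0) (sym rejectedY)))
        where
        rejectedX = step-rejected G mark X cX (Adj-sym w~v)
                      (subst (λ c → conflictFree c (X w) (cX w) (X v) ≡ false) (sym cX≡a)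
                             (offered-blocks X cX Fw (X v)))
        cY≡a′ = trans cY≡swap-cX (trans (cong (swap r b) cX≡a) (sym a′≡swap-a))
        rejectedY = step-rejected G mark Y cY (Adj-sym w~v)
                      (subst (λ c → conflictFree c (Y w) (cY w) (Y v) ≡ false) (sym cY≡a′)
                             (offered-blocks Y cY Fw (Y v)))
      cX≡swap-a = RB-≢⇒swap r≢b RBcX RBa cX≢a
      a′≢a : a′ ≢ a
      a′≢a a′≡a = swap-moves r≢b RBa (trans (sym a′≡swap-a) a′≡a)
      cY≡a : cY v ≡ a
      cY≡a = trans cY≡swap-cX (trans (cong (swap r b) cX≡swap-a) (swap-involutive r≢b RBa))

lemma2 : (G : Graph) (q : ℕ) → 2 ≤ q
    → (X Y : Fin (n G) → Fin q) (v0 : Fin (n G)) (r b : Fin q)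
    → r ≢ b → X v0 ≡ r → Y v0 ≡ b → (∀ u → u ≢ v0 → X u ≡ Y u)
    → (mark : Fin (n G) → Bool) (cX cY : Fin (n G) → Fin q)
    → Coupling.Support G X v0 r b mark cX cY Y
    → (v : Fin (n G)) → v ≢ v0 → Coupling.S G X v0 r b mark cX cY v
    → step G X cX mark v ≢ step G Y cY mark v
    → ∃ λ (k : ℕ) → ∃ λ (p : ℕ → Fin (n G)) →
        p 0 ≡ v0 × p (suc k) ≡ v
        × (∀ i → i < suc k → Adj G (p i) (p (suc i)))
        × (∀ i → i ≤ suc k → Coupling.F G X v0 r b mark cX cY i (p i))
        × cX v ≡ pick k (Y v0) (cY (p k))
        × pick k (Y v0) (cY (p k)) ≢ pick k (X v0) (cX (p k))
        × pick k (X v0) (cX (p k)) ≡ cY v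
lemma2 G q _ X Y v0 r b r≢b Xv0≡r Yv0≡b agree mark cX cY supp v v≢v0 Sv differs =
  let open CouplingFacts G X v0 r b mark cX cY
      open CoupledStep G X Y v0 r b r≢b Xv0≡r Yv0≡b agree mark cX cY supp
      open Disagreement v≢v0 Sv differs
      (d , m) = mirrored
      ((w , w~v , Fw) , _) = m
      wk = walk-snoc (walk Fw) Fw w~v
      open Walk wk
  in d , path , start , end , steps , levels-≤ wk (λ f → f) (m , proposals-flipped m)
   , subst (λ x → CrossedProposals d x v) (sym (walk-snoc-penultimate (walk Fw) Fw w~v))
           (crossed Fw w~v m)
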